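{- If $\mathbf L$ is a row-complete Latin square of order $n$, then $\chi(\mathbf L)\le 2n$.
   Context: A Latin square $\mathbf L$ of order $n$ is an $n\times n$ array with cells $(i,j)$, $0\le i,j\le n-1$, each containing one of $n$ symbols, with no symbol repeated in any row or column; $\mathbf L_{i,j}$ denotes the symbol in cell $(i,j)$. $\mathbf L$ is row-complete if the ordered pairs $(\mathbf L_{i,j},\mathbf L_{i,j+1})$, for $0\le i\le n-1$ and $0\le j\le n-2$, are all distinct. A partial transversal is a set of cells no two of which share a row, a column, or a symbol; $\chi(\mathbf L)$ is the minimum number of partial transversals of $\mathbf L$ that together cover all cells of $\mathbf L$. -}

module Defs where

open import Data.Nat using (ℕ; suc; _≤_; _<_; _*_)
open import Data.Fin using (Fin; toℕ)
open import Data.Product using (Σ; _×_; _,_; ∃-syntax)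
open import Relation.Binary.PropositionalEquality using (_≡_)

Cell : ℕ → Set
Cell n = Fin n × Fin n

Array : ℕ → Set
Array n = Fin n → Fin n → Fin n

IsLatinSquare : {n : ℕ} → Array n → Set
IsLatinSquare {n} L =
  (∀ (i j j' : Fin n) → L i j ≡ L i j' → j ≡ j') ×
  (∀ (i i' j : Fin n) → L i j ≡ L i' j → i ≡ i')

-- Row-complete: the ordered pairs (L i j , L i (j+1)), 0 ≤ j ≤ n-2, are all distinct.
-- Column j+1 is given as a Fin n index j₁ with toℕ j₁ ≡ suc (toℕ j).
IsRowComplete : {n : ℕ} → Array n → Set
IsRowComplete {n} L =
  ∀ (i j j₁ i' j' j'₁ : Fin n) →
    toℕ j₁ ≡ suc (toℕ j) → toℕ j'₁ ≡ suc (toℕ j') →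
    L i j ≡ L i' j' → L i j₁ ≡ L i' j'₁ →
    (i ≡ i') × (j ≡ j')

CellSet : ℕ → Set₁
CellSet n = Cell n → Set

IsPartialTransversal : {n : ℕ} → Array n → CellSet n → Set
IsPartialTransversal {n} L T =
  ∀ (c d : Cell n) → T c → T d →
    let (i , j) = c ; (i' , j') = d in
    (i ≡ i' → c ≡ d) × (j ≡ j' → c ≡ d) × (L i j ≡ L i' j' → c ≡ d)

CoverableBy : {n : ℕ} → Array n → ℕ → Set₁
CoverableBy {n} L k =
  Σ (Fin k → CellSet n) λ T →
    (∀ t → IsPartialTransversal L (T t)) × (∀ (c : Cell n) → ∃[ t ] T t c)

-- χ(L) ≤ m : the minimum number of partial transversals covering L is at most m,
-- i.e. some cover uses at most m partial transversals.
χ≤ : {n : ℕ} → Array n → ℕ → Set₁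
χ≤ L m = ∃[ k ] (k ≤ m × CoverableBy L k)

-- Split the cells off the last column according to the symbol to their right.
-- For a fixed symbol s, the cells whose right neighbour holds s form a partial
-- transversal: two of them in one row (column) would put s twice in one row
-- (column) of L, and two of them with equal symbols would repeat the ordered
-- pair (symbol, s), which row-completeness forbids. These n classes together
-- with the n cells of the last column, each on its own, cover L.
module Submission where

open import Defs
open import Data.Nat using (ℕ; suc; _+_; _*_)
open import Data.Nat.Properties using (suc-injective; +-identityʳ; ≤-reflexive; m≤n⇒m<n∨m≡n)
open import Data.Fin using (Fin; toℕ; fromℕ<; splitAt; _↑ˡ_; _↑ʳ_)
open import Data.Fin.Properties using (toℕ-injective; toℕ<n; toℕ-fromℕ<; splitAt-↑ˡ; splitAt-↑ʳ)
open import Data.Product using (_×_; _,_; ∃-syntax)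
open import Data.Sum using (_⊎_; inj₁; inj₂; [_,_]′)
open import Relation.Binary.PropositionalEquality using (_≡_; refl; sym; trans; cong; cong₂; subst)

_IsNextColumnOf_ : {n : ℕ} → Fin n → Fin n → Set
j₁ IsNextColumnOf j = toℕ j₁ ≡ suc (toℕ j)

IsLastColumn : {n : ℕ} → Fin n → Set
IsLastColumn {n} j = suc (toℕ j) ≡ n

nextColumn-or-last : {n : ℕ} (j : Fin n) → (∃[ j₁ ] j₁ IsNextColumnOf j) ⊎ IsLastColumn j
nextColumn-or-last j with m≤n⇒m<n∨m≡n (toℕ<n j)
... | inj₁ j+1<n = inj₁ (fromℕ< j+1<n , toℕ-fromℕ< j+1<n)
... | inj₂ j+1≡n = inj₂ j+1≡n

nextColumn-injective : {n : ℕ} {j j' j₁ j'₁ : Fin n} →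
  j₁ IsNextColumnOf j → j'₁ IsNextColumnOf j' → j₁ ≡ j'₁ → j ≡ j'
nextColumn-injective e e' refl = toℕ-injective (suc-injective (trans (sym e) e'))

nextColumn-functional : {n : ℕ} {j j₁ j'₁ : Fin n} →
  j₁ IsNextColumnOf j → j'₁ IsNextColumnOf j → j₁ ≡ j'₁
nextColumn-functional e e' = toℕ-injective (trans e (sym e'))

module _ {n : ℕ} (L : Array n) where

  subsingleton-isPartialTransversal : (T : CellSet n) →
    (∀ c d → T c → T d → c ≡ d) → IsPartialTransversal L T
  subsingleton-isPartialTransversal T unique c d p q =
    (λ _ → unique c d p q) , (λ _ → unique c d p q) , (λ _ → unique c d p q)

  coverableBy-+ : {a b : ℕ} (T : Fin a → CellSet n) (U : Fin b → CellSet n) →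
    (∀ t → IsPartialTransversal L (T t)) → (∀ u → IsPartialTransversal L (U u)) →
    (∀ c → (∃[ t ] T t c) ⊎ (∃[ u ] U u c)) → CoverableBy L (a + b)
  coverableBy-+ {a} {b} T U isPT-T isPT-U covered =
    TU , isPT-TU , covered-TU
    where
      TU : Fin (a + b) → CellSet n
      TU k = [ T , U ]′ (splitAt a k)

      isPT-TU : ∀ k → IsPartialTransversal L (TU k)
      isPT-TU k with splitAt a k
      ... | inj₁ t = isPT-T t
      ... | inj₂ u = isPT-U u

      covered-TU : ∀ c → ∃[ k ] TU k c
      covered-TU c with covered c
      ... | inj₁ (t , p) = t ↑ˡ b , subst (λ x → [ T , U ]′ x c) (sym (splitAt-↑ˡ a t b)) p
      ... | inj₂ (u , p) = a ↑ʳ u , subst (λ x → [ T , U ]′ x c) (sym (splitAt-↑ʳ a b u)) p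

  LeftOfSymbol : Fin n → CellSet n
  LeftOfSymbol s (i , j) = ∃[ j₁ ] (j₁ IsNextColumnOf j × L i j₁ ≡ s)

  LastColumnCellOfRow : Fin n → CellSet n
  LastColumnCellOfRow r (i , j) = i ≡ r × IsLastColumn j

  leftOfSymbol-isPartialTransversal : IsLatinSquare L → IsRowComplete L →
    ∀ s → IsPartialTransversal L (LeftOfSymbol s)
  leftOfSymbol-isPartialTransversal (rowLatin , columnLatin) rowComplete s
    (i , j) (i' , j') (j₁ , next , Lij₁≡s) (j'₁ , next' , Li'j'₁≡s) =
    sameRow , sameColumn , sameSymbol
    where
      Lij₁≡Li'j'₁ : L i j₁ ≡ L i' j'₁
      Lij₁≡Li'j'₁ = trans Lij₁≡s (sym Li'j'₁≡s)

      sameRow : i ≡ i' → (i , j) ≡ (i' , j')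
      sameRow refl = cong (i ,_)
        (nextColumn-injective next next' (rowLatin i j₁ j'₁ Lij₁≡Li'j'₁))

      sameColumn : j ≡ j' → (i , j) ≡ (i' , j')
      sameColumn refl with nextColumn-functional next next'
      ... | refl = cong (_, j) (columnLatin i i' j₁ Lij₁≡Li'j'₁)

      sameSymbol : L i j ≡ L i' j' → (i , j) ≡ (i' , j')
      sameSymbol Lij≡Li'j' =
        let i≡i' , j≡j' = rowComplete i j j₁ i' j' j'₁ next next' Lij≡Li'j' Lij₁≡Li'j'₁
        in cong₂ _,_ i≡i' j≡j'

  lastColumnCellOfRow-isPartialTransversal : ∀ r → IsPartialTransversal L (LastColumnCellOfRow r)
  lastColumnCellOfRow-isPartialTransversal r = subsingleton-isPartialTransversal _ unique
    where
      unique : ∀ c d → LastColumnCellOfRow r c → LastColumnCellOfRow r d → c ≡ d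
      unique (i , j) (i' , j') (refl , last) (refl , last') =
        cong (i ,_) (toℕ-injective (suc-injective (trans last (sym last'))))

  leftOfSymbol-or-lastColumn : ∀ c → (∃[ s ] LeftOfSymbol s c) ⊎ (∃[ r ] LastColumnCellOfRow r c)
  leftOfSymbol-or-lastColumn (i , j) with nextColumn-or-last j
  ... | inj₁ (j₁ , next) = inj₁ (L i j₁ , j₁ , next , refl)
  ... | inj₂ last        = inj₂ (i , refl , last)

mainTheorem4 : (n : ℕ) (L : Array n) → IsLatinSquare L → IsRowComplete L → χ≤ L (2 * n)
mainTheorem4 n L latin rowComplete =
  n + n ,
  ≤-reflexive (cong (n +_) (sym (+-identityʳ n))) ,
  coverableBy-+ L (LeftOfSymbol L) (LastColumnCellOfRow L)
    (leftOfSymbol-isPartialTransversal L latin rowComplete)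
    (lastColumnCellOfRow-isPartialTransversal L)
    (leftOfSymbol-or-lastColumn L)
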